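{- Fix a code retrieving function $\rho$ (all triples below are w.r.t. $\rho$). Let $G$ be a reflexive state relation and assume (1) $R(P)\subseteq P$, (2) $\models\{R,P\cap C\}\,p\,\{P,G\}$, (3) $\models\{R,P\cap\overline C\}\,q\,\{Q,G\}$, where $\overline C$ is the complement of $C$. Then $\models\{R,P\}\,\mathbf{while}\,C\,p\,q\,\{Q,G\}$.
   Context: Program terms over a state type $\alpha$ are generated by $p::=\mathbf{skip}\mid\mathbf{basic}\,f\mid\mathbf{cjump}\,C\,i\,p\mid\mathbf{while}\,C\,p\,p\mid\mathbf{if}\,C\,p\,p\mid p;p\mid\Vert(p_1,\dots,p_m)\mid\mathbf{await}\,C\,p$ ($f:\alpha\to\alpha$, $C\subseteq\alpha$, $i\in\mathbb N$, $m\ge1$). A code retrieving function $\rho$ maps $\mathbb N$ to terms. The program step relation $\rho\vdash(p,\sigma)\to_{\mathcal P}(p',\sigma')$ is the least relation with: $(\mathbf{basic}\,f,\sigma)\to(\mathbf{skip},f\sigma)$; $(\mathbf{cjump}\,C\,i\,p,\sigma)\to(\rho\,i,\sigma)$ if $\sigma\in C$, $\to(p,\sigma)$ otherwise; $(\mathbf{await}\,C\,p,\sigma)\to(\mathbf{skip},\sigma')$ if $\sigma\in C$ and $(p,\sigma)\to^*(\mathbf{skip},\sigma')$; $(\mathbf{if}\,C\,p_1\,p_2,\sigma)\to(p_1,\sigma)$ if $\sigma\in C$, $\to(p_2,\sigma)$ otherwise; for $x=\mathbf{while}\,C\,p_1\,p_2$: $(x,\sigma)\to(p_1;(\mathbf{skip};x),\sigma)$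 if $\sigma\in C$, $\to(p_2,\sigma)$ otherwise; $(p_1;p_2,\sigma)\to(p_1';p_2,\sigma')$ if $(p_1,\sigma)\to(p_1',\sigma')$; $(\mathbf{skip};p,\sigma)\to(p,\sigma)$; $(\Vert(\dots,p_i,\dots),\sigma)\to(\Vert(\dots,p_i',\dots),\sigma')$ if $(p_i,\sigma)\to(p_i',\sigma')$; $(\Vert(\mathbf{skip},\dots,\mathbf{skip}),\sigma)\to(\mathbf{skip},\sigma)$. A finite potential computation of $(\rho,p)$ is a nonempty finite sequence $(p_0,\sigma_0),\dots,(p_{n-1},\sigma_{n-1})$ with $p_0=p$ where each transition is a program step or an environment step ($p_{i+1}=p_i$, state arbitrary). For state relations $R,G\subseteq\alpha\times\alpha$ and state predicates $P,Q\subseteq\alpha$, $\models\{R,P\}\,p\,\{Q,G\}$ means: every finite potential computation of $(\rho,p)$ with $\sigma_0\in P$ and $(\sigma_i,\sigma_{i+1})\in R$ for all environment steps has $(\sigma_i,\sigma_{i+1})\in G$ for all program steps and, if some $p_i=\mathbf{skip}$, $\sigma_i\in Q$ for the least such $i$. $R(X)=\{b\mid\exists a\in X.(a,b)\in R\}$. -}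

module Defs where

open import Data.Nat using (ℕ; zero; suc; _<_)
open import Data.Fin using (Fin)
open import Data.Vec using (Vec; lookup; _[_]≔_)
open import Data.Vec.Relation.Unary.All using (All)
open import Data.Product using (_×_; _,_; proj₁; proj₂)
open import Relation.Binary.PropositionalEquality using (_≡_; _≢_)
open import Relation.Binary.Construct.Closure.ReflexiveTransitive using (Star)
open import Relation.Nullary using (¬_)
open import Data.Unit using (⊤)
open import Data.Empty using (⊥)

Pred : Set → Set₁
Pred α = α → Set

Rel : Set → Set₁
Rel α = α → α → Set

_∩_ : {α : Set} → Pred α → Pred α → Pred α
(P ∩ C) σ = P σ × C σ

compl : {α : Set} → Pred α → Pred α
compl C σ = ¬ C σ

-- program terms; parallel composition of m ≥ 1 components: par m ps, ps of length suc m
data Prog (α : Set) : Set₁ where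
  skip  : Prog α
  basic : (α → α) → Prog α
  cjump : Pred α → ℕ → Prog α → Prog α
  while : Pred α → Prog α → Prog α → Prog α
  if    : Pred α → Prog α → Prog α → Prog α
  _⨾_   : Prog α → Prog α → Prog α
  par   : (m : ℕ) → Vec (Prog α) (suc m) → Prog α
  await : Pred α → Prog α → Prog α

Cfg : Set → Set₁
Cfg α = Prog α × α

data Step {α : Set} (ρ : ℕ → Prog α) : Cfg α → Cfg α → Set₁ where
  basicS  : ∀ {f σ} → Step ρ (basic f , σ) (skip , f σ)
  cjumpT  : ∀ {C i p σ} → C σ → Step ρ (cjump C i p , σ) (ρ i , σ)
  cjumpF  : ∀ {C i p σ} → ¬ C σ → Step ρ (cjump C i p , σ) (p , σ)
  awaitS  : ∀ {C p σ σ'} → C σ → Star (Step ρ) (p , σ) (skip , σ') →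
            Step ρ (await C p , σ) (skip , σ')
  ifT     : ∀ {C p₁ p₂ σ} → C σ → Step ρ (if C p₁ p₂ , σ) (p₁ , σ)
  ifF     : ∀ {C p₁ p₂ σ} → ¬ C σ → Step ρ (if C p₁ p₂ , σ) (p₂ , σ)
  whileT  : ∀ {C p₁ p₂ σ} → C σ →
            Step ρ (while C p₁ p₂ , σ) (p₁ ⨾ (skip ⨾ while C p₁ p₂) , σ)
  whileF  : ∀ {C p₁ p₂ σ} → ¬ C σ → Step ρ (while C p₁ p₂ , σ) (p₂ , σ)
  seqS    : ∀ {p₁ p₁' p₂ σ σ'} → Step ρ (p₁ , σ) (p₁' , σ') →
            Step ρ (p₁ ⨾ p₂ , σ) (p₁' ⨾ p₂ , σ')
  seqSkip : ∀ {p σ} → Step ρ (skip ⨾ p , σ) (p , σ)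
  parS    : ∀ {m ps p' σ σ'} (i : Fin (suc m)) → Step ρ (lookup ps i , σ) (p' , σ') →
            Step ρ (par m ps , σ) (par m (ps [ i ]≔ p') , σ')
  parFin  : ∀ {m ps σ} → All (_≡ skip) ps → Step ρ (par m ps , σ) (skip , σ)

data Trans {α : Set} (ρ : ℕ → Prog α) : Cfg α → Cfg α → Set₁ where
  envT  : ∀ {p σ σ'} → Trans ρ (p , σ) (p , σ')
  progT : ∀ {c c'} → Step ρ c c' → Trans ρ c c'

IsEnv : ∀ {α ρ} {c c' : Cfg α} → Trans ρ c c' → Set
IsEnv envT = ⊤
IsEnv (progT _) = ⊥

IsProg : ∀ {α ρ} {c c' : Cfg α} → Trans ρ c c' → Set
IsProg envT = ⊥
IsProg (progT _) = ⊤

-- finite potential computation of (ρ , p) of length n ≥ 1, given as c 0 , … , c (n-1)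
record PotComp {α : Set} (ρ : ℕ → Prog α) (p : Prog α) (n : ℕ) (c : ℕ → Cfg α) : Set₁ where
  field
    nonempty : 0 < n
    start    : proj₁ (c 0) ≡ p
    trans    : ∀ i → suc i < n → Trans ρ (c i) (c (suc i))

Valid : {α : Set} (ρ : ℕ → Prog α) → Rel α → Pred α → Prog α → Pred α → Rel α → Set₁
Valid ρ R P p Q G =
  ∀ n c (pc : PotComp ρ p n c) →
  P (proj₂ (c 0)) →
  (∀ i (lt : suc i < n) → IsEnv (PotComp.trans pc i lt) → R (proj₂ (c i)) (proj₂ (c (suc i)))) →
  (∀ i (lt : suc i < n) → IsProg (PotComp.trans pc i lt) → G (proj₂ (c i)) (proj₂ (c (suc i))))
  × (∀ i → i < n → proj₁ (c i) ≡ skip → (∀ j → j < i → proj₁ (c j) ≢ skip) → Q (proj₂ (c i)))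

Stable : {α : Set} → Rel α → Pred α → Set
Stable R P = ∀ a b → P a → R a b → P b

Reflexive : {α : Set} → Rel α → Set
Reflexive G = ∀ σ → G σ σ

module Submission where

-- Every finite potential computation of  while C p q  from a state in P passes through
-- a sequence of phases: it waits at the loop, runs the body  p ⨾ (skip ⨾ while C p q)  after
-- an unfolding in a state of P ∩ C, discards the two skips and returns to the loop, or leaves
-- to  q  in a state of P ∩ ¬C and stays there.  P is maintained outside p and q because it is
-- stable under R and the loop's own steps do not change the state (hence are in G since G is
-- reflexive); inside p or q the hypotheses on p and q apply to the corresponding window of
-- the computation.

open import Defs
open import Data.Nat using () renaming (ℕ to ℕ')
open import Data.Nat using (ℕ; zero; suc; _+_; _<_; _≤_; z≤n; s≤s; s≤s⁻¹)
open import Data.Nat.Properties using (<⇒≤; ≤-<-trans; +-monoˡ-≤; <-irrelevant; n<1+n; ≤-refl; +-monoˡ-<; m≤n⇒m<n∨m≡n)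
open import Data.Product using (Σ; _×_; _,_; proj₁; proj₂)
open import Data.Sum using (inj₁; inj₂)
open import Data.Unit using (tt)
open import Data.Empty using (⊥; ⊥-elim)
open import Function using (id)
open import Relation.Binary.PropositionalEquality using (_≡_; _≢_; refl; sym; trans; cong; subst)
open import Relation.Nullary using (¬_; Dec; yes; no)

extendBelow : ∀ {ℓ} {A : ℕ → Set ℓ} {m : ℕ} →
  (∀ j → j < m → A j) → A m → ∀ j → j < suc m → A j
extendBelow below atM j j<1+m with m≤n⇒m<n∨m≡n (s≤s⁻¹ j<1+m)
... | inj₁ j<m = below j j<m
... | inj₂ refl = atM

isSkip? : ∀ {α} (x : Prog α) → Dec (x ≡ skip)
isSkip? skip = yes refl
isSkip? (basic _) = no λ ()
isSkip? (cjump _ _ _) = no λ ()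
isSkip? (while _ _ _) = no λ ()
isSkip? (if _ _ _) = no λ ()
isSkip? (_ ⨾ _) = no λ ()
isSkip? (par _ _) = no λ ()
isSkip? (await _ _) = no λ ()

mapProg : ∀ {α} → (Prog α → Prog α) → Cfg α → Cfg α
mapProg f x = f (proj₁ x) , proj₂ x

seqHead : ∀ {α} → Prog α → Prog α
seqHead (l ⨾ _) = l
seqHead x = x

EnvRespects : ∀ {α ρ p n c} → PotComp {α} ρ p n c → Rel α → Set
EnvRespects {c = c} pc R =
  ∀ i lt → IsEnv (PotComp.trans pc i lt) → R (proj₂ (c i)) (proj₂ (c (suc i)))

stutter : ∀ {α} (G : Rel α) → Reflexive G → ∀ {a b} → b ≡ a → G a b
stutter G G-refl same = subst (G _) (sym same) (G-refl _)

module _ {α : Set} {ρ : ℕ → Prog α} where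

  -- Two transitions are both environment steps or both program steps; a simulation must
  -- preserve this so that rely and guarantee conditions transfer between computations.
  data SameKind : {x y x' y' : Cfg α} → Trans ρ x y → Trans ρ x' y' → Set₁ where
    envs  : ∀ {p σ σ' p' τ τ'} → SameKind (envT {p = p} {σ} {σ'}) (envT {p = p'} {τ} {τ'})
    progs : ∀ {x y x' y'} {s : Step ρ x y} {s' : Step ρ x' y'} → SameKind (progT s) (progT s')

  sameKind-refl : ∀ {x y} (t : Trans ρ x y) → SameKind t t
  sameKind-refl envT = envs
  sameKind-refl (progT _) = progs

  sameKind-env : ∀ {x y x' y'} {t : Trans ρ x y} {t' : Trans ρ x' y'} →
    SameKind t t' → IsEnv t' → IsEnv t
  sameKind-env envs _ = tt

  sameKind-prog : ∀ {x y x' y'} {t : Trans ρ x y} {t' : Trans ρ x' y'} →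
    SameKind t t' → IsProg t → IsProg t'
  sameKind-prog progs _ = tt

  env-not-prog : ∀ {x y} (t : Trans ρ x y) → IsEnv t → IsProg t → ⊥
  env-not-prog envT _ ()

  data LoopMove (C : Pred α) (p q : Prog α) {x y : Cfg α} (t : Trans ρ x y) : Set₁ where
    envMove : IsEnv t → proj₁ y ≡ while C p q → LoopMove C p q t
    enter   : C (proj₂ x) → proj₁ y ≡ p ⨾ (skip ⨾ while C p q) → proj₂ y ≡ proj₂ x → LoopMove C p q t
    leave   : ¬ C (proj₂ x) → proj₁ y ≡ q → proj₂ y ≡ proj₂ x → LoopMove C p q t

  loopMove : ∀ {C p q x y} → proj₁ x ≡ while C p q → (t : Trans ρ x y) → LoopMove C p q t
  loopMove refl envT = envMove tt refl
  loopMove refl (progT (whileT c)) = enter c refl refl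
  loopMove refl (progT (whileF ¬c)) = leave ¬c refl refl

  data SkipSeqMove (Z : Prog α) {x y : Cfg α} (t : Trans ρ x y) : Set₁ where
    envMove : IsEnv t → proj₁ y ≡ skip ⨾ Z → SkipSeqMove Z t
    discard : proj₁ y ≡ Z → proj₂ y ≡ proj₂ x → SkipSeqMove Z t

  skipSeqMove : ∀ {Z x y} → proj₁ x ≡ skip ⨾ Z → (t : Trans ρ x y) → SkipSeqMove Z t
  skipSeqMove refl envT = envMove tt refl
  skipSeqMove refl (progT (seqS ()))
  skipSeqMove refl (progT seqSkip) = discard refl refl

  seqMove : ∀ {L Z x y} → proj₁ x ≡ L ⨾ Z → L ≢ skip → (t : Trans ρ x y) →
    (Σ (Prog α) λ L' → proj₁ y ≡ L' ⨾ Z) ×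
    Σ (Trans ρ (mapProg seqHead x) (mapProg seqHead y)) (SameKind t)
  seqMove refl _ envT = (_ , refl) , envT , envs
  seqMove refl _ (progT (seqS s)) = (_ , refl) , progT s , progs
  seqMove refl unfinished (progT seqSkip) = ⊥-elim (unfinished refl)

-- Let c be a computation and consider its configurations k, …, m + k read through
-- f. If each transition of the window is simulated by a transition of the same kind between
-- the read configurations, these form a potential computation of  f (proj₁ (c k)); hence a
-- valid specification of that program yields the guarantee on the window's program steps
-- and its postcondition at the first point where the read program is skip.
module Window {α : Set} {ρ : ℕ → Prog α} {p₀ : Prog α} {n : ℕ} {c : ℕ → Cfg α}
  (pc : PotComp ρ p₀ n c) (f : Prog α → Prog α) (k m : ℕ) (inside : m + k < n)
  (simulate : ∀ j → j < m → (lt : suc (j + k) < n) →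
    Σ (Trans ρ (mapProg f (c (j + k))) (mapProg f (c (suc (j + k)))))
      (SameKind (PotComp.trans pc (j + k) lt)))
  where

  view : ℕ → Cfg α
  view j = mapProg f (c (j + k))

  private
    inWindow : ∀ {j} → suc j < suc m → suc (j + k) < n
    inWindow (s≤s j<m) = ≤-<-trans (+-monoˡ-≤ k j<m) inside

    viewStep : ∀ j (l : suc j < suc m) → Σ (Trans ρ (view j) (view (suc j)))
                 (SameKind (PotComp.trans pc (j + k) (inWindow l)))
    viewStep j l = simulate j (s≤s⁻¹ l) (inWindow l)

  module Apply {R G : Rel α} {P' Q' : Pred α} {p' : Prog α} (valid : Valid ρ R P' p' Q' G)
    (env : EnvRespects pc R) (start : f (proj₁ (c k)) ≡ p') (pre : P' (proj₂ (c k))) where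

    private
      viewComp : PotComp ρ p' (suc m) view
      viewComp = record { nonempty = s≤s z≤n ; start = start ; trans = λ j l → proj₁ (viewStep j l) }

      outcome :
        (∀ j (l : suc j < suc m) → IsProg (PotComp.trans viewComp j l) →
          G (proj₂ (view j)) (proj₂ (view (suc j)))) ×
        (∀ j → j < suc m → proj₁ (view j) ≡ skip → (∀ j' → j' < j → proj₁ (view j') ≢ skip) →
          Q' (proj₂ (view j)))
      outcome = valid (suc m) view viewComp pre
        (λ j l isEnv → env (j + k) (inWindow l) (sameKind-env (proj₂ (viewStep j l)) isEnv))

    guarantee : ∀ j (lt : suc (j + k) < n) → j < m → IsProg (PotComp.trans pc (j + k) lt) →
      G (proj₂ (c (j + k))) (proj₂ (c (suc (j + k))))
    guarantee j lt j<m isProg =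
      proj₁ outcome j (s≤s j<m) (sameKind-prog (proj₂ (viewStep j (s≤s j<m))) isProg')
      where
      isProg' : IsProg (PotComp.trans pc (j + k) (inWindow (s≤s j<m)))
      isProg' = subst (λ l → IsProg (PotComp.trans pc (j + k) l)) (<-irrelevant lt _) isProg

    post : ∀ j → j ≤ m → f (proj₁ (c (j + k))) ≡ skip →
      (∀ j' → j' < j → f (proj₁ (c (j' + k))) ≢ skip) → Q' (proj₂ (c (j + k)))
    post j j≤m = proj₂ outcome j (s≤s j≤m)

module WhileRule {α : Set} (ρ : ℕ → Prog α) (R G : Rel α) (P Q C : Pred α) (p q : Prog α)
  (G-refl : Reflexive G) (P-stable : Stable R P)
  (bodySpec : Valid ρ R (P ∩ C) p P G) (exitSpec : Valid ρ R (P ∩ compl C) q Q G)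
  {n : ℕ} {c : ℕ → Cfg α} (pc : PotComp ρ (while C p q) n c)
  (pre : P (proj₂ (c 0))) (env : EnvRespects pc R) where

  loop unfolded : Prog α
  loop = while C p q
  unfolded = skip ⨾ loop

  π : ℕ → Prog α
  π i = proj₁ (c i)

  σ : ℕ → α
  σ i = proj₂ (c i)

  step : ∀ i (lt : suc i < n) → Trans ρ (c i) (c (suc i))
  step = PotComp.trans pc

  Unfinished : Prog α → Set₁
  Unfinished x = Σ (Prog α) λ L → x ≡ L ⨾ unfolded × L ≢ skip

  unfinished-head : ∀ {x} → Unfinished x → seqHead x ≢ skip
  unfinished-head (_ , refl , ne) = ne

  bodySimulation : ∀ k m → (∀ j → j < m → Unfinished (π (j + k))) →
    ∀ j → j < m → (lt : suc (j + k) < n) →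
    Σ (Trans ρ (mapProg seqHead (c (j + k))) (mapProg seqHead (c (suc (j + k)))))
      (SameKind (step (j + k) lt))
  bodySimulation k m run j j<m lt with run j j<m
  ... | _ , shape , ne = proj₂ (seqMove shape ne (step (j + k) lt))

  exitSimulation : ∀ k m j → j < m → (lt : suc (j + k) < n) →
    Σ (Trans ρ (mapProg id (c (j + k))) (mapProg id (c (suc (j + k))))) (SameKind (step (j + k) lt))
  exitSimulation k m j _ lt = step (j + k) lt , sameKind-refl _

  module Body k m inside run (start : π k ≡ p ⨾ unfolded) entry =
    Window.Apply pc seqHead k m inside (bodySimulation k m run)
      {R} {G} {P ∩ C} {P} bodySpec env (cong seqHead start) entry
  module Exit k m inside (start : π k ≡ q) entry =
    Window.Apply pc id k m inside (exitSimulation k m)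
      {R} {G} {P ∩ compl C} {Q} exitSpec env start entry

  -- The phase of configuration i. A body run started at k (just after an unfolding) and has
  -- lasted m transitions with the body unfinished before i; an exit started at k.
  data Phase (i : ℕ) : Set₁ where
    atLoop     : π i ≡ loop → P (σ i) → Phase i
    inBody     : (k m : ℕ) → i ≡ m + k → π k ≡ p ⨾ unfolded → (P ∩ C) (σ k) →
                 (∀ j → j < m → Unfinished (π (j + k))) →
                 (Σ (Prog α) λ L → π i ≡ L ⨾ unfolded) → Phase i
    bodyDone   : π i ≡ skip ⨾ unfolded → P (σ i) → Phase i
    atUnfolded : π i ≡ unfolded → P (σ i) → Phase i
    inExit     : (k m : ℕ) → i ≡ m + k → π k ≡ q → (P ∩ compl C) (σ k) → Phase i

  persist : ∀ {i} (lt : suc i < n) → IsEnv (step i lt) → P (σ i) → P (σ (suc i))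
  persist lt isEnv Pσ = P-stable _ _ Pσ (env _ lt isEnv)

  fromSkipSeq : ∀ {i Z} (lt : suc i < n) → π i ≡ skip ⨾ Z → P (σ i) →
    (π (suc i) ≡ skip ⨾ Z → P (σ (suc i)) → Phase (suc i)) →
    (π (suc i) ≡ Z → P (σ (suc i)) → Phase (suc i)) →
    Phase (suc i) × (IsProg (step i lt) → G (σ i) (σ (suc i)))
  fromSkipSeq {i} lt shape Pσ stay next with skipSeqMove shape (step i lt)
  ... | envMove isEnv shape' = stay shape' (persist lt isEnv Pσ) , λ isProg → ⊥-elim (env-not-prog _ isEnv isProg)
  ... | discard shape' same = next shape' (subst P (sym same) Pσ) , λ _ → stutter G G-refl same

  -- One transition: the next phase, and the guarantee for the transition if it is a program
  -- step. Inside p or q the guarantee comes from the window of the body or exit so far.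
  advance : ∀ i (lt : suc i < n) → Phase i →
    Phase (suc i) × (IsProg (step i lt) → G (σ i) (σ (suc i)))
  advance i lt (atLoop shape Pσ) with loopMove shape (step i lt)
  ... | envMove isEnv shape' = atLoop shape' (persist lt isEnv Pσ) , λ isProg → ⊥-elim (env-not-prog _ isEnv isProg)
  ... | enter holds shape' same =
    inBody (suc i) 0 refl shape' (subst P (sym same) Pσ , subst C (sym same) holds) (λ _ ()) (_ , shape') ,
    λ _ → stutter G G-refl same
  ... | leave fails shape' same =
    inExit (suc i) 0 refl shape' (subst P (sym same) Pσ , subst (compl C) (sym same) fails) ,
    λ _ → stutter G G-refl same
  advance i lt (bodyDone shape Pσ) = fromSkipSeq lt shape Pσ bodyDone atUnfolded
  advance i lt (atUnfolded shape Pσ) = fromSkipSeq lt shape Pσ atUnfolded atLoop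
  advance i lt (inExit k m refl start entry) =
    inExit k (suc m) refl start entry ,
    Exit.guarantee k (suc m) lt start entry m lt (n<1+n m)
  advance i lt (inBody k m refl start entry run (L , shape)) with isSkip? L
  ... | yes refl = fromSkipSeq lt shape bodyPost bodyDone atUnfolded
    where
    bodyPost : P (σ i)
    bodyPost = Body.post k m (<⇒≤ lt) run start entry m ≤-refl
                 (cong seqHead shape) (λ j j<m → unfinished-head (run j j<m))
  ... | no unfinished =
    inBody k (suc m) refl start entry run' (proj₁ (seqMove shape unfinished (step i lt))) ,
    Body.guarantee k (suc m) lt run' start entry m lt (n<1+n m)
    where
    run' : ∀ j → j < suc m → Unfinished (π (j + k))
    run' = extendBelow run (L , shape , unfinished)

  phase : ∀ i → i < n → Phase i
  phase zero _ = atLoop (PotComp.start pc) pre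
  phase (suc i) lt = proj₁ (advance i lt (phase i (<⇒≤ lt)))

  guarantee : ∀ i (lt : suc i < n) → IsProg (step i lt) → G (σ i) (σ (suc i))
  guarantee i lt = proj₂ (advance i lt (phase i (<⇒≤ lt)))

  -- Only the exit phase can be at skip; there the postcondition of q applies.
  post : ∀ i → i < n → π i ≡ skip → (∀ j → j < i → π j ≢ skip) → Q (σ i)
  post i i<n done before with phase i i<n
  ... | atLoop shape _ with () ← trans (sym shape) done
  ... | inBody _ _ _ _ _ _ (_ , shape) with () ← trans (sym shape) done
  ... | bodyDone shape _ with () ← trans (sym shape) done
  ... | atUnfolded shape _ with () ← trans (sym shape) done
  ... | inExit k m refl start entry =
    Exit.post k m i<n start entry m ≤-refl done
      (λ j j<m → before (j + k) (+-monoˡ-< k j<m))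

mainTheorem4 : {α : Set} (ρ : ℕ' → Prog α) (R G : Rel α) (P Q C : Pred α) (p q : Prog α) →
    Reflexive G →
    Stable R P →
    Valid ρ R (P ∩ C) p P G →
    Valid ρ R (P ∩ compl C) q Q G →
    Valid ρ R P (while C p q) Q G
mainTheorem4 ρ R G P Q C p q G-refl P-stable bodySpec exitSpec n c pc pre env = guarantee , post
  where open WhileRule ρ R G P Q C p q G-refl P-stable bodySpec exitSpec pc pre env
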